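{- Let $T$ be a proper binary tree with saturated vertices $u$ and $w$ such that $R_T(u)=R_T(w)$. Let $u_1,w_1$ be the siblings and $u_0,w_0$ the parents of $u,w$ respectively, and assume that $u_0$ is an ancestor of $w_0$. If $R_T(w_1)\ge R_T(u)=R_T(w)$ and $T^*=T-uu_0-w_1w_0+uw_0+w_1u_0$ (i.e. the subtrees $T(u)$ and $T(w_1)$ are exchanged; $T^*$ has the same root as $T$), then $R(T^*)\ge R(T)$.
   Context: All trees are rooted; $T(v)$ is the subtree induced by $v$ and its descendants; a leaf is a vertex with no children. The rank $R_T(v)$ is the minimum distance from $v$ to a leaf of $T(v)$, and the security is $R(T)=\sum_{v}R_T(v)$. A proper binary tree is an unordered rooted tree in which every non-leaf vertex has exactly two children. A complete binary tree is a proper binary tree whose leaves are all at the same distance from its root. A vertex $v$ of a proper binary tree $T$ is saturated if $T(v)$ is a complete binary tree but $T(x)$ is not a complete binary tree for any proper ancestor $x$ of $v$. -}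

module Defs where

open import Data.Nat using (ℕ; zero; suc; _+_; _⊓_)
open import Data.List using (List; []; _∷_; _++_)
open import Data.Product using (Σ; ∃; _×_; _,_)
open import Data.Empty using (⊥)
open import Relation.Binary.PropositionalEquality using (_≡_)
open import Relation.Nullary using (¬_)

-- Proper binary trees: every vertex is a leaf or has exactly two children.
-- (Ordered representation of an unordered tree; all quantities below are
-- invariant under swapping children.)
data Tree : Set where
  leaf : Tree
  node : Tree → Tree → Tree

-- Vertices are addressed by their path from the root.
data Dir : Set where
  L R : Dir

flipDir : Dir → Dir
flipDir L = R
flipDir R = L

Path : Set
Path = List Dir

data SubAt : Tree → Path → Tree → Set where
  here  : ∀ {t} → SubAt t [] t
  goL   : ∀ {l r p s} → SubAt l p s → SubAt (node l r) (L ∷ p) s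
  goR   : ∀ {l r p s} → SubAt r p s → SubAt (node l r) (R ∷ p) s

rank : Tree → ℕ
rank leaf       = 0
rank (node l r) = suc (rank l ⊓ rank r)

security : Tree → ℕ
security leaf         = 0
security (node l r)   = rank (node l r) + security l + security r

data AllLeavesAt : ℕ → Tree → Set where
  leafAt : AllLeavesAt zero leaf
  nodeAt : ∀ {n l r} → AllLeavesAt n l → AllLeavesAt n r → AllLeavesAt (suc n) (node l r)

Complete : Tree → Set
Complete t = ∃ λ n → AllLeavesAt n t

_≼_ : Path → Path → Set
p ≼ q = ∃ λ r → p ++ r ≡ q

_≺_ : Path → Path → Set
p ≺ q = Σ Dir λ d → Σ Path λ r → p ++ (d ∷ r) ≡ q

Saturated : Tree → Path → Set
Saturated T v =
  (∃ λ S → SubAt T v S × Complete S) ×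
  (∀ x → x ≺ v → ∀ S → SubAt T x S → ¬ Complete S)

replace : Tree → Path → Tree → Tree
replace t          []      s = s
replace leaf       (_ ∷ _) s = leaf
replace (node l r) (L ∷ p) s = node (replace l p s) r
replace (node l r) (R ∷ p) s = node l (replace r p s)

{-# OPTIONS --safe #-}
module Submission where

-- Replacing a subtree changes only the ranks of its ancestors, and monotonically in
-- its rank; so a replacement that does not lower rank or security does not lower them
-- in the whole tree. As T(u) is complete and w is saturated, w₀ is not below u: either
-- w₀ = u₀, where the exchange swaps two siblings or does nothing, or w₀ lies in the
-- subtree B of the sibling of u. There R(w) ≤ R(u) keeps the rank at w₀, so B keeps
-- its rank and loses at most R(T(w₁)) − R(T(u)) of security, which is regained at u₀
-- where T(w₁) replaces T(u) without lowering the rank there, as R(u) ≤ R(w₁).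

open import Defs
open import Data.Nat using (ℕ; _≤_; _+_; _⊓_; s≤s)
open import Data.Nat.Properties
  using (≤-refl; ≤-trans; ≤-reflexive; +-mono-≤; +-monoˡ-≤; +-monoʳ-≤; +-comm; ⊓-mono-≤; ⊓-glb; ⊓-comm; m⊓n≤m; m⊓n≤n)
open import Data.Nat.Tactic.RingSolver using (solve-∀)
open import Data.List using ([]; _∷_; _++_; _∷ʳ_)
open import Data.List.Properties using (++-assoc)
open import Data.Product using (∃; _×_; _,_; proj₂)
open import Data.Empty using (⊥-elim)
open import Relation.Nullary using (¬_)
open import Relation.Binary.PropositionalEquality using (_≡_; refl; sym; cong; subst; subst₂)

SubAt-prefix : ∀ {T p q S} → SubAt T (p ++ q) S → ∃ λ N → SubAt T p N
SubAt-prefix {p = []}    _        = _ , here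
SubAt-prefix {p = L ∷ p} (goL at) = let N , at′ = SubAt-prefix {p = p} at in N , goL at′
SubAt-prefix {p = R ∷ p} (goR at) = let N , at′ = SubAt-prefix {p = p} at in N , goR at′

SubAt-suffix : ∀ {T p q N S} → SubAt T p N → SubAt T (p ++ q) S → SubAt N q S
SubAt-suffix here      at       = at
SubAt-suffix (goL atN) (goL at) = SubAt-suffix atN at
SubAt-suffix (goR atN) (goR at) = SubAt-suffix atN at

replace-++ : ∀ {T p q N} X → SubAt T p N → replace T (p ++ q) X ≡ replace T p (replace N q X)
replace-++ X here      = refl
replace-++ X (goL atN) = cong (λ l → node l _) (replace-++ X atN)
replace-++ X (goR atN) = cong (node _) (replace-++ X atN)

replace-replace-++ : ∀ {T p q q′ N} X Y → SubAt T p N →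
  replace (replace T (p ++ q) X) (p ++ q′) Y ≡ replace T p (replace (replace N q X) q′ Y)
replace-replace-++ X Y here      = refl
replace-replace-++ X Y (goL atN) = cong (λ l → node l _) (replace-replace-++ X Y atN)
replace-replace-++ X Y (goR atN) = cong (node _) (replace-replace-++ X Y atN)

≼⇒≺∷ʳ : ∀ {p q d} → p ≼ q → p ≺ (q ∷ʳ d)
≼⇒≺∷ʳ {p} {d = d} ([]    , refl) = d , [] , sym (++-assoc p [] (d ∷ []))
≼⇒≺∷ʳ {p} {d = d} (e ∷ r , refl) = e , r ∷ʳ d , sym (++-assoc p (e ∷ r) (d ∷ []))

≺-++ˡ : ∀ s {p q} → p ≺ q → (s ++ p) ≺ (s ++ q)
≺-++ˡ s {p} (d , r , refl) = d , r , ++-assoc s p (d ∷ r)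

saturated-¬≺ : ∀ {T u w} → Saturated T u → Saturated T w → ¬ (u ≺ w)
saturated-¬≺ ((S , at-u , complete) , _) (_ , incomplete-above-w) u≺w =
  incomplete-above-w _ u≺w S at-u complete

infix 4 _⊑⟨_,_⟩_

-- S′ has rank at least that of S, and security at least that of S plus a − b,
-- an integer stated without subtraction.
_⊑⟨_,_⟩_ : Tree → ℕ → ℕ → Tree → Set
S ⊑⟨ a , b ⟩ S′ = rank S ≤ rank S′ × a + security S ≤ b + security S′

node-⊑ : ∀ {l r l′ r′ a b} → rank l ⊓ rank r ≤ rank l′ ⊓ rank r′ →
  a + (security l + security r) ≤ b + (security l′ + security r′) →
  node l r ⊑⟨ a , b ⟩ node l′ r′
node-⊑ {l} {r} {l′} {r′} {a} {b} rank≤ security≤ =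
  s≤s rank≤ ,
  subst₂ _≤_ (shuffle a (rank (node l r)) (security l) (security r))
             (shuffle b (rank (node l′ r′)) (security l′) (security r′))
             (+-mono-≤ (s≤s rank≤) security≤)
  where
  shuffle : ∀ a x s t → x + (a + (s + t)) ≡ a + (x + s + t)
  shuffle = solve-∀

node-⊑ˡ : ∀ {l l′ r a b} → l ⊑⟨ a , b ⟩ l′ → node l r ⊑⟨ a , b ⟩ node l′ r
node-⊑ˡ {l} {l′} {r} {a} {b} (rank≤ , security≤) =
  node-⊑ (⊓-mono-≤ rank≤ ≤-refl)
         (subst₂ _≤_ (assoc a (security l) (security r)) (assoc b (security l′) (security r))
                 (+-monoˡ-≤ (security r) security≤))
  where
  assoc : ∀ a s t → a + s + t ≡ a + (s + t)
  assoc = solve-∀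

node-⊑ʳ : ∀ {l r r′ a b} → r ⊑⟨ a , b ⟩ r′ → node l r ⊑⟨ a , b ⟩ node l r′
node-⊑ʳ {l} {r} {r′} {a} {b} (rank≤ , security≤) =
  node-⊑ (⊓-mono-≤ (≤-refl {rank l}) rank≤)
         (subst₂ _≤_ (exchange a (security l) (security r)) (exchange b (security l) (security r′))
                 (+-monoʳ-≤ (security l) security≤))
  where
  exchange : ∀ a s t → s + (a + t) ≡ a + (s + t)
  exchange = solve-∀

replace-mono : ∀ {T p S S′ a b} → SubAt T p S → S ⊑⟨ a , b ⟩ S′ → T ⊑⟨ a , b ⟩ replace T p S′
replace-mono here     S⊑S′ = S⊑S′
replace-mono (goL at) S⊑S′ = node-⊑ˡ (replace-mono at S⊑S′)
replace-mono (goR at) S⊑S′ = node-⊑ʳ (replace-mono at S⊑S′)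

sibling-exchange : ∀ {M d Tw Tw₁ X} → SubAt M (d ∷ []) Tw → SubAt M (flipDir d ∷ []) Tw₁ →
  rank Tw ≤ rank X → M ⊑⟨ security X , security Tw₁ ⟩ replace M (flipDir d ∷ []) X
sibling-exchange {Tw = Tw} {Tw₁} {X} (goL here) (goR here) w≤x =
  node-⊑ (⊓-glb (m⊓n≤m (rank Tw) (rank Tw₁)) (≤-trans (m⊓n≤m (rank Tw) (rank Tw₁)) w≤x))
         (≤-reflexive (exchange (security X) (security Tw) (security Tw₁)))
  where
  exchange : ∀ x w w₁ → x + (w + w₁) ≡ w₁ + (w + x)
  exchange = solve-∀
sibling-exchange {Tw = Tw} {Tw₁} {X} (goR here) (goL here) w≤x =
  node-⊑ (⊓-glb (≤-trans (m⊓n≤n (rank Tw₁) (rank Tw)) w≤x) (m⊓n≤n (rank Tw₁) (rank Tw)))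
         (≤-reflexive (exchange (security X) (security Tw) (security Tw₁)))
  where
  exchange : ∀ x w w₁ → x + (w₁ + w) ≡ w₁ + (x + w)
  exchange = solve-∀

exchange-below : ∀ {B r d Tw Tw₁ X} → SubAt B (r ∷ʳ d) Tw → SubAt B (r ∷ʳ flipDir d) Tw₁ →
  rank Tw ≤ rank X → B ⊑⟨ security X , security Tw₁ ⟩ replace B (r ∷ʳ flipDir d) X
exchange-below {B} {r} {X = X} at-w at-w₁ w≤x =
  let _ , at-parent = SubAt-prefix {p = r} at-w
  in subst (B ⊑⟨ _ , _ ⟩_) (sym (replace-++ X at-parent))
       (replace-mono at-parent
         (sibling-exchange (SubAt-suffix at-parent at-w) (SubAt-suffix at-parent at-w₁) w≤x))

node-comm-⊑ : ∀ {l r} → node l r ⊑⟨ 0 , 0 ⟩ node r l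
node-comm-⊑ {l} {r} =
  node-⊑ {a = 0} {b = 0} (≤-reflexive (⊓-comm (rank l) (rank r)))
                         (≤-reflexive (+-comm (security l) (security r)))

-- In the coordinates of the parent u₀ of u: N = T(u₀) and w₀ = u₀ ++ r.
exchange-at-parent : ∀ {N du dw r Tu Tw Tw₁} →
  SubAt N (du ∷ []) Tu → SubAt N (r ∷ʳ dw) Tw → SubAt N (r ∷ʳ flipDir dw) Tw₁ →
  ¬ ((du ∷ []) ≼ r) → rank Tw ≤ rank Tu → rank Tu ≤ rank Tw₁ →
  N ⊑⟨ 0 , 0 ⟩ replace (replace N (du ∷ []) Tw₁) (r ∷ʳ flipDir dw) Tu
exchange-at-parent {r = []} (goL here) (goL here) (goR here) _ _ _ = node-comm-⊑
exchange-at-parent {r = []} (goR here) (goR here) (goL here) _ _ _ = node-comm-⊑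
exchange-at-parent {r = []} (goL here) (goR here) (goL here) _ _ _ = ≤-refl , ≤-refl
exchange-at-parent {r = []} (goR here) (goL here) (goR here) _ _ _ = ≤-refl , ≤-refl
exchange-at-parent {r = L ∷ r} (goL here) _ _ u⋠w₀ _ _ = ⊥-elim (u⋠w₀ (r , refl))
exchange-at-parent {r = R ∷ r} (goR here) _ _ u⋠w₀ _ _ = ⊥-elim (u⋠w₀ (r , refl))
exchange-at-parent {r = R ∷ r} (goL here) (goR at-w) (goR at-w₁) _ w≤u u≤w₁ =
  let rank≤ , security≤ = exchange-below at-w at-w₁ w≤u
  in node-⊑ {a = 0} {b = 0} (⊓-mono-≤ u≤w₁ rank≤) security≤
exchange-at-parent {r = L ∷ r} {Tu} {Tw₁ = Tw₁} (goR here) (goL at-w) (goL at-w₁) _ w≤u u≤w₁ =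
  let rank≤ , security≤ = exchange-below at-w at-w₁ w≤u
  in node-⊑ {a = 0} {b = 0} (⊓-mono-≤ rank≤ u≤w₁)
       (subst₂ _≤_ (+-comm (security Tu) _) (+-comm (security Tw₁) _) security≤)

lemma2p5 : (T : Tree) (u₀ w₀ : Path) (du dw : Dir) (Tu Tw Tw₁ : Tree) →
    Saturated T (u₀ ++ (du ∷ [])) →
    Saturated T (w₀ ++ (dw ∷ [])) →
    SubAt T (u₀ ++ (du ∷ [])) Tu →
    SubAt T (w₀ ++ (dw ∷ [])) Tw →
    SubAt T (w₀ ++ (flipDir dw ∷ [])) Tw₁ →
    rank Tu ≡ rank Tw →
    u₀ ≼ w₀ →
    rank Tu ≤ rank Tw₁ →
    security T ≤ security (replace (replace T (u₀ ++ (du ∷ [])) Tw₁) (w₀ ++ (flipDir dw ∷ [])) Tu)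
lemma2p5 T u₀ .(u₀ ++ r) du dw Tu Tw Tw₁ sat-u sat-w at-u at-w at-w₁ u≡w (r , refl) u≤w₁
  rewrite ++-assoc u₀ r (dw ∷ []) | ++-assoc u₀ r (flipDir dw ∷ []) =
  let N , at-u₀ = SubAt-prefix at-u
      N⊑N* = exchange-at-parent (SubAt-suffix at-u₀ at-u) (SubAt-suffix at-u₀ at-w)
               (SubAt-suffix at-u₀ at-w₁) u⋠w₀ (≤-reflexive (sym u≡w)) u≤w₁
  in subst (λ T* → security T ≤ security T*) (sym (replace-replace-++ Tw₁ Tu at-u₀))
       (proj₂ (replace-mono at-u₀ N⊑N*))
  where
  u⋠w₀ : ¬ ((du ∷ []) ≼ r)
  u⋠w₀ u≼r = saturated-¬≺ sat-u sat-w (≺-++ˡ u₀ (≼⇒≺∷ʳ u≼r))
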